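{- $f(3,3) = 2-\sqrt{2}$.
   Context: For an integer $s\ge 1$ let $\Sigma_s=\{0,1,\ldots,s-1\}$ with its natural total order. An $n$-word over $\Sigma_s$ is a sequence $w=(w_1,\ldots,w_n)\in(\Sigma_s)^n$. A subword is a subsequence $w_{i_1}\cdots w_{i_k}$ with $i_1<\cdots<i_k$ (counted by position sets); it is monotone if it is non-decreasing or non-increasing. Let $m(k,w)$ be the number of monotone $k$-subwords of $w$, $f(s,k,n)=\min_{w\in(\Sigma_s)^n} m(k,w)/\binom{n}{k}$, and $f(s,k)=\lim_{n\to\infty} f(s,k,n)$. -}

module Defs where

open import Data.Bool using (Bool; true; false; _∧_; _∨_)
open import Data.Nat using (ℕ; zero; suc; _≤ᵇ_; _⊓_)
open import Data.Nat.Combinatorics using (_C_)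
open import Data.Fin using (Fin; toℕ)
open import Data.List using (List; []; _∷_; [_]; map; _++_; length; filterᵇ; concatMap; allFin; foldr)
open import Data.Integer using (+_)
open import Data.Rational using (ℚ; _/_; _<_; _≤_; _-_; _*_; 0ℚ)
open import Data.Sum using (_⊎_)
open import Data.Product using (_×_)

-- all k-element subsequences of a list, counted by position sets
choose : {A : Set} → ℕ → List A → List (List A)
choose zero    xs       = [ [] ]
choose (suc k) []       = []
choose (suc k) (x ∷ xs) = map (x ∷_) (choose k xs) ++ choose (suc k) xs

allWords : (s n : ℕ) → List (List (Fin s))
allWords s zero    = [ [] ]
allWords s (suc n) = concatMap (λ w → map (_∷ w) (allFin s)) (allWords s n)

nonDecreasing : {s : ℕ} → List (Fin s) → Bool
nonDecreasing []           = true
nonDecreasing (x ∷ [])     = true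
nonDecreasing (x ∷ y ∷ xs) = (toℕ x ≤ᵇ toℕ y) ∧ nonDecreasing (y ∷ xs)

nonIncreasing : {s : ℕ} → List (Fin s) → Bool
nonIncreasing []           = true
nonIncreasing (x ∷ [])     = true
nonIncreasing (x ∷ y ∷ xs) = (toℕ y ≤ᵇ toℕ x) ∧ nonIncreasing (y ∷ xs)

monotone : {s : ℕ} → List (Fin s) → Bool
monotone u = nonDecreasing u ∨ nonIncreasing u

m : {s : ℕ} → ℕ → List (Fin s) → ℕ
m k w = length (filterᵇ monotone (choose k w))

-- min over all n-words of m(k,w); the start value binom(n,k) is an upper
-- bound for every m(k,w), so this is exactly the minimum
minMono : (s k n : ℕ) → ℕ
minMono s k n = foldr _⊓_ (n C k) (map (m k) (allWords s n))

-- a / d as a rational (d = 0 never occurs for n ≥ k; value then irrelevant)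
ratio : ℕ → ℕ → ℚ
ratio a zero    = 0ℚ
ratio a (suc d) = (+ a) / suc d

f : (s k n : ℕ) → ℚ
f s k n = ratio (minMono s k n) (n C k)

two : ℚ
two = + 2 / 1

-- q < 2 - √2, expressed with rational arithmetic
BelowTarget : ℚ → Set
BelowTarget q = (q < two) × (two < (two - q) * (two - q))

-- 2 - √2 < q, expressed with rational arithmetic
AboveTarget : ℚ → Set
AboveTarget q = (two ≤ q) ⊎ ((two - q) * (two - q) < two)

-- Let a word w over {0,1,2} have k letters in {0,2} and p letters 1, n = k + p.  Reading w from
-- right to left as a walk (0 up, 2 down, 1 flat), the number ν(w) of its non-monotone 3-subwords
-- satisfies the exact identity
--   24·ν(w) + 3·S₁ + 6·S₂ + 6·S₃ = Ψ(k,p) = k³ + 2k + 6kp² + 6k²p,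
-- with S₁, S₂, S₃ sums of squares over the positions of w; it is proved by induction on w through a
-- polynomial Φ in nine suffix statistics.  Hence m(3,w) ≥ C(n,3) − Ψ(k,p)/24, which for x = k/n is
-- (1 − (x³ − 6x² + 6x)/4 + O(1/n))·C(n,3), and the minimum of that over x ∈ [0,1] is 2 − √2.
-- Conversely, for w = 1^⌈p/2⌉ (02)^j 1^⌊p/2⌋ one has S₁ = 4j, S₂ ≤ 2j, S₃ = 0, so taking 2j ≈ b·n
-- gives m(3,w)/C(n,3) → 1 − (b³ − 6b² + 6b)/4, which lies below b for every b ∈ (2 − √2, 1).
-- Both comparisons reduce to integer polynomial inequalities in n, certified by sums of nonnegative terms.

module Submission where

open import Data.Bool using (Bool; true; false; not; if_then_else_)
open import Data.Bool.Properties using (if-eta)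
open import Data.Empty using (⊥; ⊥-elim)
open import Data.Fin using (Fin; zero; suc)
open import Data.Integer using (ℤ; +_; -[1+_]; 0ℤ; _+_; _-_; _*_; -_; _≤_; _<_; +≤+; -≤+; +<+; ∣_∣; nonNegative)
import Data.Integer.Properties as ℤ
open import Data.Integer.Tactic.RingSolver using (solve-∀)
open import Data.List using (List; []; _∷_; length; map; _++_; filterᵇ; foldr; allFin; replicate)
open import Data.List.Properties using (length-++; length-map; length-replicate)
open import Data.List.Relation.Unary.All as All using (All; []; _∷_)
open import Data.List.Relation.Unary.All.Properties using (concat⁺; map⁺)
open import Data.List.Relation.Unary.Any using (here; there)
open import Data.List.Membership.Propositional using (_∈_)
open import Data.List.Membership.Propositional.Properties using (∈-map⁺; ∈-map⁻; ∈-concat⁺′)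
open import Data.Nat as ℕ using (ℕ; zero; suc; z≤n; s≤s; _⊓_; ⌊_/2⌋; ⌈_/2⌉)
import Data.Nat.Properties as ℕ
open import Data.Nat.Combinatorics using (_C_; nCk+nC[k+1]≡[n+1]C[k+1]; nC1≡n)
open import Data.Nat.DivMod using (_/_; _%_; m≡m%n+[m/n]*n; m%n<n)
open import Data.Product using (∃; _×_; _,_; proj₁; proj₂)
open import Data.Rational as ℚ using (ℚ; ↥_; ↧_; 1ℚ)
import Data.Rational.Properties as ℚ
import Data.Rational.Unnormalised as ℚᵘ
import Data.Rational.Unnormalised.Properties as ℚᵘ
import Data.Sum as Sum
open import Data.Sum using (_⊎_; inj₁; inj₂)
open import Relation.Binary.PropositionalEquality
open import Relation.Nullary using (yes; no)
open import Relation.Nullary.Decidable using (toWitness; toWitnessFalse)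
open ≡-Reasoning

open import Defs


count : {A : Set} → (A → Bool) → List A → ℕ
count p []       = 0
count p (x ∷ xs) = if p x then suc (count p xs) else count p xs

module _ {A : Set} (p : A → Bool) where

  length-filterᵇ : ∀ xs → length (filterᵇ p xs) ≡ count p xs
  length-filterᵇ []       = refl
  length-filterᵇ (x ∷ xs) with p x
  ... | true  = cong suc (length-filterᵇ xs)
  ... | false = length-filterᵇ xs

  count-++ : ∀ xs ys → count p (xs ++ ys) ≡ count p xs ℕ.+ count p ys
  count-++ []       ys = refl
  count-++ (x ∷ xs) ys with p x
  ... | true  = cong suc (count-++ xs ys)
  ... | false = count-++ xs ys

  count-+-count-not : ∀ xs → count p xs ℕ.+ count (λ x → not (p x)) xs ≡ length xs
  count-+-count-not []       = refl
  count-+-count-not (x ∷ xs) with p x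
  ... | true  = cong suc (count-+-count-not xs)
  ... | false = trans (ℕ.+-suc _ _) (cong suc (count-+-count-not xs))

count-true : {A : Set} (xs : List A) → count (λ _ → true) xs ≡ length xs
count-true []       = refl
count-true (x ∷ xs) = cong suc (count-true xs)

count-map : {A B : Set} (p : B → Bool) (g : A → B) (xs : List A) → count p (map g xs) ≡ count (λ x → p (g x)) xs
count-map p g []       = refl
count-map p g (x ∷ xs) with p (g x)
... | true  = cong suc (count-map p g xs)
... | false = count-map p g xs

length-choose : {A : Set} (k : ℕ) (xs : List A) → length (choose k xs) ≡ length xs C k
length-choose zero    xs       = refl
length-choose (suc k) []       = refl
length-choose (suc k) (x ∷ xs) = begin
  length (map (x ∷_) (choose k xs) ++ choose (suc k) xs)
    ≡⟨ length-++ (map (x ∷_) (choose k xs)) ⟩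
  length (map (x ∷_) (choose k xs)) ℕ.+ length (choose (suc k) xs)
    ≡⟨ cong₂ ℕ._+_ (trans (length-map (x ∷_) (choose k xs)) (length-choose k xs)) (length-choose (suc k) xs) ⟩
  length xs C k ℕ.+ length xs C suc k
    ≡⟨ nCk+nC[k+1]≡[n+1]C[k+1] (length xs) k ⟩
  suc (length xs) C suc k ∎

count-choose-suc : {A : Set} (p : List A → Bool) (k : ℕ) (x : A) (xs : List A) →
  count p (choose (suc k) (x ∷ xs)) ≡ count (λ u → p (x ∷ u)) (choose k xs) ℕ.+ count p (choose (suc k) xs)
count-choose-suc p k x xs =
  trans (count-++ p (map (x ∷_) (choose k xs)) (choose (suc k) xs))
        (cong (ℕ._+ count p (choose (suc k) xs)) (count-map p (x ∷_) (choose k xs)))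

count-choose-1 : {A : Set} (p : List A → Bool) (xs : List A) → count p (choose 1 xs) ≡ count (λ z → p (z ∷ [])) xs
count-choose-1 p []       = refl
count-choose-1 p (z ∷ zs) with p (z ∷ [])
... | true  = cong suc (count-choose-1 p zs)
... | false = count-choose-1 p zs

-- Closure of 0ℤ ≤_ under + and *, written infix so that positivity certificates mirror their polynomials.
infixl 6 _⊕_
infixl 7 _⊗_

_⊕_ : ∀ {a b} → 0ℤ ≤ a → 0ℤ ≤ b → 0ℤ ≤ a + b
_⊕_ = ℤ.+-mono-≤

_⊗_ : ∀ {a b} → 0ℤ ≤ a → 0ℤ ≤ b → 0ℤ ≤ a * b
_⊗_ {+ m} {+ n} _ _ = subst (0ℤ ≤_) (ℤ.pos-* m n) (+≤+ z≤n)

0≤+ : ∀ n → 0ℤ ≤ + n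
0≤+ n = +≤+ z≤n

square-nonneg : ∀ x → 0ℤ ≤ x * x
square-nonneg (+ zero)    = +≤+ z≤n
square-nonneg (+ (suc n)) = +≤+ z≤n
square-nonneg -[1+ n ]    = +≤+ z≤n

pos-*-+ : ∀ c a b → + c * + (a ℕ.+ b) ≡ + c * + a + + c * + b
pos-*-+ c a b = trans (cong (+ c *_) (ℤ.pos-+ a b)) (ℤ.*-distribˡ-+ (+ c) (+ a) (+ b))

0≤-of-≤ : ∀ {x y} → x ≤ y → 0ℤ ≤ y - x
0≤-of-≤ = ℤ.i≤j⇒0≤j-i

0≤-of-< : ∀ {x y} → x < y → 0ℤ ≤ y - x - + 1
0≤-of-< {x} {y} x<y = subst (0ℤ ≤_) (shift x y) (ℤ.i≤j⇒0≤j-i (ℤ.i<j⇒suc[i]≤j x<y))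
  where
  shift : ∀ x y → y - (+ 1 + x) ≡ y - x - + 1
  shift = solve-∀

<-of-0≤ : ∀ {x y} → 0ℤ ≤ y - x - + 1 → x < y
<-of-0≤ {x} {y} h = ℤ.suc[i]≤j⇒i<j (ℤ.0≤i-j⇒j≤i (subst (0ℤ ≤_) (shift x y) h))
  where
  shift : ∀ x y → y - x - + 1 ≡ y - (+ 1 + x)
  shift = solve-∀

0≤-of-pos : ∀ {x} → 0ℤ ≤ x - + 1 → 0ℤ ≤ x
0≤-of-pos {x} h = subst (0ℤ ≤_) (shift x) (h ⊕ 0≤+ 1)
  where
  shift : ∀ x → x - + 1 + + 1 ≡ x
  shift = solve-∀

pos-* : ∀ {a b} → 0ℤ ≤ a - + 1 → 0ℤ ≤ b - + 1 → 0ℤ ≤ a * b - + 1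
pos-* {a} {b} ha hb = subst (0ℤ ≤_) (expand a b) (ha ⊗ hb ⊕ ha ⊕ hb)
  where
  expand : ∀ a b → (a - + 1) * (b - + 1) + (a - + 1) + (b - + 1) ≡ a * b - + 1
  expand = solve-∀

private
  ≥1-cancel : ∀ {c x} → + 1 ≤ c → + 1 ≤ c * x → + 1 ≤ x
  ≥1-cancel {+ suc m} {+ suc n}  _ _ = +≤+ (s≤s z≤n)
  ≥1-cancel {+ suc m} {+ zero}   _ h rewrite ℤ.*-zeroʳ (+ suc m) with h
  ... | +≤+ ()
  ≥1-cancel {+ suc m} { -[1+ n ]} _ ()
  ≥1-cancel {+ zero}  (+≤+ ()) _

pos-cancel : ∀ {c x} → 0ℤ ≤ c - + 1 → 0ℤ ≤ c * x - + 1 → 0ℤ ≤ x - + 1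
pos-cancel {c} {x} hc hcx = ℤ.i≤j⇒0≤j-i (≥1-cancel {c} {x} (ℤ.0≤i-j⇒j≤i {c} hc) (ℤ.0≤i-j⇒j≤i {c * x} hcx))

nonneg-cancel : ∀ {c x} → 0ℤ ≤ c - + 1 → 0ℤ ≤ c * x → 0ℤ ≤ x
nonneg-cancel {+ suc m} {+ n}      _ _ = +≤+ z≤n
nonneg-cancel {+ suc m} { -[1+ n ]} _ ()
nonneg-cancel {+ zero}  { -[1+ n ]} () _
nonneg-cancel {+ zero}  {+ n}       () _
nonneg-cancel { -[1+ m ]}           () _

suffixSum : {A : Set} → (A → Bool) → (List A → ℤ) → List A → ℤ
suffixSum p g []      = 0ℤ
suffixSum p g (x ∷ w) = if p x then g (x ∷ w) + suffixSum p g w else suffixSum p g w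

count≡suffixSum : {A : Set} (p : A → Bool) (xs : List A) → + count p xs ≡ suffixSum p (λ _ → + 1) xs
count≡suffixSum p []       = refl
count≡suffixSum p (x ∷ xs) with p x
... | true  = cong (λ s → + 1 + s) (count≡suffixSum p xs)
... | false = count≡suffixSum p xs

module _ {A : Set} (p : A → Bool) where

  suffixSum-nonneg : {g : List A → ℤ} → (∀ u → 0ℤ ≤ g u) → ∀ w → 0ℤ ≤ suffixSum p g w
  suffixSum-nonneg g≥0 []      = 0≤+ 0
  suffixSum-nonneg g≥0 (x ∷ w) with p x
  ... | true  = g≥0 (x ∷ w) ⊕ suffixSum-nonneg g≥0 w
  ... | false = suffixSum-nonneg g≥0 w

  suffixSum-square : ∀ a (h : List A → ℤ) w →
    suffixSum p (λ u → (a - + 2 * h u) * (a - + 2 * h u)) w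
      ≡ a * a * suffixSum p (λ _ → + 1) w - + 4 * a * suffixSum p h w + + 4 * suffixSum p (λ u → h u * h u) w
  suffixSum-square a h []      = empty a
    where
    empty : ∀ a → 0ℤ ≡ a * a * 0ℤ - + 4 * a * 0ℤ + + 4 * 0ℤ
    empty = solve-∀
  suffixSum-square a h (x ∷ w) with p x
  ... | true  = trans (cong (λ s → (a - + 2 * h (x ∷ w)) * (a - + 2 * h (x ∷ w)) + s) (suffixSum-square a h w))
                      (step a (h (x ∷ w)) (suffixSum p (λ _ → + 1) w) (suffixSum p h w) (suffixSum p (λ u → h u * h u) w))
    where
    step : ∀ a y N H H² → (a - + 2 * y) * (a - + 2 * y) + (a * a * N - + 4 * a * H + + 4 * H²)
                        ≡ a * a * (+ 1 + N) - + 4 * a * (y + H) + + 4 * (y * y + H²)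
    step = solve-∀
  ... | false = suffixSum-square a h w

Word : Set
Word = List (Fin 3)

nonMonotone : Word → Bool
nonMonotone u = not (monotone u)

nonMono : Word → ℕ
nonMono w = count nonMonotone (choose 3 w)

m+nonMono≡C : ∀ w → m 3 w ℕ.+ nonMono w ≡ length w C 3
m+nonMono≡C w = begin
  m 3 w ℕ.+ nonMono w
    ≡⟨ cong (ℕ._+ nonMono w) (length-filterᵇ monotone (choose 3 w)) ⟩
  count monotone (choose 3 w) ℕ.+ nonMono w
    ≡⟨ count-+-count-not monotone (choose 3 w) ⟩
  length (choose 3 w)
    ≡⟨ length-choose 3 w ⟩
  length w C 3 ∎

nonMonoAfter : Fin 3 → Word → ℕ
nonMonoAfter x w = count (λ u → nonMonotone (x ∷ u)) (choose 2 w)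

nonMono-∷ : ∀ x w → nonMono (x ∷ w) ≡ nonMonoAfter x w ℕ.+ nonMono w
nonMono-∷ x w = count-choose-suc nonMonotone 2 x w

nonMonoAfter-∷ : ∀ x y w →
  nonMonoAfter x (y ∷ w) ≡ count (λ z → nonMonotone (x ∷ y ∷ z ∷ [])) w ℕ.+ nonMonoAfter x w
nonMonoAfter-∷ x y w =
  trans (count-choose-suc (λ u → nonMonotone (x ∷ u)) 1 y w)
        (cong (ℕ._+ nonMonoAfter x w) (count-choose-1 (λ u → nonMonotone (x ∷ y ∷ u)) w))

is0 is1 is2 isStep : Fin 3 → Bool
is0 zero = true
is0 _    = false
is1 (suc zero) = true
is1 _          = false
is2 (suc (suc zero)) = true
is2 _                = false
isStep x = not (is1 x)

zeros ones twos drift : Word → ℤ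
zeros = suffixSum is0 (λ _ → + 1)
ones  = suffixSum is1 (λ _ → + 1)
twos  = suffixSum is2 (λ _ → + 1)
drift w = zeros w - twos w

-- Read w from right to left as a walk: 0 steps up, 2 steps down, 1 stays flat;
-- drift u is the height of the walk at the first letter of the suffix u.
stepDrift stepDrift² stepOnes stepOnes² flatDrift flatDrift² : Word → ℤ
stepDrift  = suffixSum isStep drift
stepDrift² = suffixSum isStep (λ u → drift u * drift u)
stepOnes   = suffixSum isStep ones
stepOnes²  = suffixSum isStep (λ u → ones u * ones u)
flatDrift  = suffixSum is1 drift
flatDrift² = suffixSum is1 (λ u → drift u * drift u)

when : Bool → ℤ → ℤ
when b x = if b then x else 0ℤ

letterCount : (Fin 3 → Bool) → Word → ℤ
letterCount p w = when (p zero) (zeros w) + when (p (suc zero)) (ones w) + when (p (suc (suc zero))) (twos w)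

count-letters : ∀ p w → + count p w ≡ letterCount p w
count-letters p [] =
  sym (cong₂ _+_ (cong₂ _+_ (if-eta (p zero)) (if-eta (p (suc zero)))) (if-eta (p (suc (suc zero)))))
count-letters p (zero ∷ w) with p zero | count-letters p w
... | true  | ih = trans (cong (λ s → + 1 + s) ih) (shift (zeros w) (when (p (suc zero)) (ones w)) (when (p (suc (suc zero))) (twos w)))
  where
  shift : ∀ a b c → + 1 + (a + b + c) ≡ (+ 1 + a) + b + c
  shift = solve-∀
... | false | ih = ih
count-letters p (suc zero ∷ w) with p (suc zero) | count-letters p w
... | true  | ih = trans (cong (λ s → + 1 + s) ih) (shift (when (p zero) (zeros w)) (ones w) (when (p (suc (suc zero))) (twos w)))
  where
  shift : ∀ a b c → + 1 + (a + b + c) ≡ a + (+ 1 + b) + c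
  shift = solve-∀
... | false | ih = ih
count-letters p (suc (suc zero) ∷ w) with p (suc (suc zero)) | count-letters p w
... | true  | ih = trans (cong (λ s → + 1 + s) ih) (shift (when (p zero) (zeros w)) (when (p (suc zero)) (ones w)) (twos w))
  where
  shift : ∀ a b c → + 1 + (a + b + c) ≡ a + b + (+ 1 + c)
  shift = solve-∀
... | false | ih = ih

length-letters : ∀ w → + length w ≡ zeros w + ones w + twos w
length-letters w = trans (cong +_ (sym (count-true w))) (count-letters (λ _ → true) w)

count-steps : ∀ w → suffixSum isStep (λ _ → + 1) w ≡ zeros w + twos w
count-steps w = trans (sym (count≡suffixSum isStep w))
  (trans (count-letters isStep w) (cong (_+ twos w) (ℤ.+-identityʳ (zeros w))))

-- Counting the non-monotone triples

after₀ after₂ : (z o t A E : ℤ) → ℤ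
after₀ z o t A E = + 4 * E + + 2 * z * t - (z + t + + 1) * (z - t) + + 2 * A + + 4 * t * o
after₂ z o t A E = + 4 * z * o - + 4 * E + + 2 * z * t + (z + t + + 1) * (z - t) - + 2 * A
{-# INLINE after₀ #-}
{-# INLINE after₂ #-}

after₁ : (z t B : ℤ) → ℤ
after₁ z t B = + 4 * (B + z * t)
{-# INLINE after₁ #-}

after : Fin 3 → Word → ℤ
after zero             w = after₀ (zeros w) (ones w) (twos w) (stepDrift w) (flatDrift w)
after (suc zero)       w = after₁ (zeros w) (twos w) (stepOnes w)
after (suc (suc zero)) w = after₂ (zeros w) (ones w) (twos w) (stepDrift w) (flatDrift w)

after-∷ : ∀ x y w → + 4 * letterCount (λ z → nonMonotone (x ∷ y ∷ z ∷ [])) w + after x w ≡ after x (y ∷ w)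
after-∷ zero zero w = step (zeros w) (ones w) (twos w) (stepDrift w) (flatDrift w)
  where
  step : ∀ z o t A E → + 4 * (0ℤ + 0ℤ + 0ℤ) + after₀ z o t A E ≡ after₀ (+ 1 + z) o t (+ 1 + z - t + A) E
  step = solve-∀
after-∷ zero (suc zero) w = step (zeros w) (ones w) (twos w) (stepDrift w) (flatDrift w)
  where
  step : ∀ z o t A E → + 4 * (z + 0ℤ + 0ℤ) + after₀ z o t A E ≡ after₀ z (+ 1 + o) t A (z - t + E)
  step = solve-∀
after-∷ zero (suc (suc zero)) w = step (zeros w) (ones w) (twos w) (stepDrift w) (flatDrift w)
  where
  step : ∀ z o t A E → + 4 * (z + o + 0ℤ) + after₀ z o t A E ≡ after₀ z o (+ 1 + t) (z - (+ 1 + t) + A) E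
  step = solve-∀
after-∷ (suc zero) zero w = step (zeros w) (ones w) (twos w) (stepOnes w)
  where
  step : ∀ z o t B → + 4 * (0ℤ + o + t) + after₁ z t B ≡ after₁ (+ 1 + z) t (o + B)
  step = solve-∀
after-∷ (suc zero) (suc zero) w = step (zeros w) (twos w) (stepOnes w)
  where
  step : ∀ z t B → + 4 * (0ℤ + 0ℤ + 0ℤ) + after₁ z t B ≡ after₁ z t B
  step = solve-∀
after-∷ (suc zero) (suc (suc zero)) w = step (zeros w) (ones w) (twos w) (stepOnes w)
  where
  step : ∀ z o t B → + 4 * (z + o + 0ℤ) + after₁ z t B ≡ after₁ z (+ 1 + t) (o + B)
  step = solve-∀
after-∷ (suc (suc zero)) zero w = step (zeros w) (ones w) (twos w) (stepDrift w) (flatDrift w)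
  where
  step : ∀ z o t A E → + 4 * (0ℤ + o + t) + after₂ z o t A E ≡ after₂ (+ 1 + z) o t (+ 1 + z - t + A) E
  step = solve-∀
after-∷ (suc (suc zero)) (suc zero) w = step (zeros w) (ones w) (twos w) (stepDrift w) (flatDrift w)
  where
  step : ∀ z o t A E → + 4 * (0ℤ + 0ℤ + t) + after₂ z o t A E ≡ after₂ z (+ 1 + o) t A (z - t + E)
  step = solve-∀
after-∷ (suc (suc zero)) (suc (suc zero)) w = step (zeros w) (ones w) (twos w) (stepDrift w) (flatDrift w)
  where
  step : ∀ z o t A E → + 4 * (0ℤ + 0ℤ + 0ℤ) + after₂ z o t A E ≡ after₂ z o (+ 1 + t) (z - (+ 1 + t) + A) E
  step = solve-∀

nonMonoAfter-formula : ∀ x w → + 4 * + nonMonoAfter x w ≡ after x w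
nonMonoAfter-formula zero             [] = refl
nonMonoAfter-formula (suc zero)       [] = refl
nonMonoAfter-formula (suc (suc zero)) [] = refl
nonMonoAfter-formula x (y ∷ w) = begin
  + 4 * + nonMonoAfter x (y ∷ w)                   ≡⟨ cong (λ n → + 4 * + n) (nonMonoAfter-∷ x y w) ⟩
  + 4 * + (count p w ℕ.+ nonMonoAfter x w)         ≡⟨ pos-*-+ 4 (count p w) (nonMonoAfter x w) ⟩
  + 4 * + count p w + + 4 * + nonMonoAfter x w     ≡⟨ cong₂ (λ a b → + 4 * a + b) (count-letters p w) (nonMonoAfter-formula x w) ⟩
  + 4 * letterCount p w + after x w                ≡⟨ after-∷ x y w ⟩
  after x (y ∷ w)                                  ∎
  where
  p = λ z → nonMonotone (x ∷ y ∷ z ∷ [])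

Φ-poly : (z o t A A² B B² E E² : ℤ) → ℤ
Φ-poly z o t A A² B B² E E² =
  let k = z + t ; d = z - t in
  k * k * k + + 2 * k - + 12 * A² + + 12 * d * A - + 3 * k * d * d
  + + 24 * o * B - + 24 * B² + + 24 * o * z * t + + 24 * d * E - + 24 * E²
{-# INLINE Φ-poly #-}

Φ : Word → ℤ
Φ w = Φ-poly (zeros w) (ones w) (twos w) (stepDrift w) (stepDrift² w) (stepOnes w) (stepOnes² w) (flatDrift w) (flatDrift² w)

Φ-∷ : ∀ x w → + 6 * after x w + Φ w ≡ Φ (x ∷ w)
Φ-∷ zero w = step (zeros w) (ones w) (twos w) (stepDrift w) (stepDrift² w) (stepOnes w) (stepOnes² w) (flatDrift w) (flatDrift² w)
  where
  step : ∀ z o t A A² B B² E E² → + 6 * after₀ z o t A E + Φ-poly z o t A A² B B² E E²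
       ≡ Φ-poly (+ 1 + z) o t (+ 1 + z - t + A) ((+ 1 + z - t) * (+ 1 + z - t) + A²) (o + B) (o * o + B²) E E²
  step = solve-∀
Φ-∷ (suc zero) w = step (zeros w) (ones w) (twos w) (stepDrift w) (stepDrift² w) (stepOnes w) (stepOnes² w) (flatDrift w) (flatDrift² w)
  where
  step : ∀ z o t A A² B B² E E² → + 6 * after₁ z t B + Φ-poly z o t A A² B B² E E²
       ≡ Φ-poly z (+ 1 + o) t A A² B B² (z - t + E) ((z - t) * (z - t) + E²)
  step = solve-∀
Φ-∷ (suc (suc zero)) w = step (zeros w) (ones w) (twos w) (stepDrift w) (stepDrift² w) (stepOnes w) (stepOnes² w) (flatDrift w) (flatDrift² w)
  where
  step : ∀ z o t A A² B B² E E² → + 6 * after₂ z o t A E + Φ-poly z o t A A² B B² E E²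
       ≡ Φ-poly z o (+ 1 + t) (z - (+ 1 + t) + A) ((z - (+ 1 + t)) * (z - (+ 1 + t)) + A²) (o + B) (o * o + B²) E E²
  step = solve-∀

nonMono-formula : ∀ w → + 24 * + nonMono w ≡ Φ w
nonMono-formula []      = refl
nonMono-formula (x ∷ w) = begin
  + 24 * + nonMono (x ∷ w)                              ≡⟨ cong (λ n → + 24 * + n) (nonMono-∷ x w) ⟩
  + 24 * + (nonMonoAfter x w ℕ.+ nonMono w)             ≡⟨ pos-*-+ 24 (nonMonoAfter x w) (nonMono w) ⟩
  + 24 * + nonMonoAfter x w + + 24 * + nonMono w        ≡⟨ cong (_+ + 24 * + nonMono w) (ℤ.*-assoc (+ 6) (+ 4) (+ nonMonoAfter x w)) ⟩
  + 6 * (+ 4 * + nonMonoAfter x w) + + 24 * + nonMono w ≡⟨ cong₂ (λ a b → + 6 * a + b) (nonMonoAfter-formula x w) (nonMono-formula w) ⟩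
  + 6 * after x w + Φ w                                 ≡⟨ Φ-∷ x w ⟩
  Φ (x ∷ w)                                             ∎

Ψ : ℤ → ℤ → ℤ
Ψ k p = k * k * k + + 2 * k + + 6 * k * p * p + + 6 * p * k * k
{-# INLINE Ψ #-}

squares : Word → ℤ
squares w = + 3 * suffixSum isStep (λ u → (drift w - + 2 * drift u) * (drift w - + 2 * drift u)) w
          + + 6 * suffixSum isStep (λ u → (ones w - + 2 * ones u) * (ones w - + 2 * ones u)) w
          + + 6 * suffixSum is1 (λ u → (drift w - + 2 * drift u) * (drift w - + 2 * drift u)) w

squares-nonneg : ∀ w → 0ℤ ≤ squares w
squares-nonneg w =
  0≤+ 3 ⊗ suffixSum-nonneg isStep (λ u → square-nonneg (drift w - + 2 * drift u)) w
  ⊕ 0≤+ 6 ⊗ suffixSum-nonneg isStep (λ u → square-nonneg (ones w - + 2 * ones u)) w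
  ⊕ 0≤+ 6 ⊗ suffixSum-nonneg is1 (λ u → square-nonneg (drift w - + 2 * drift u)) w

Φ+squares≡Ψ : ∀ w → Φ w + squares w ≡ Ψ (zeros w + twos w) (ones w)
Φ+squares≡Ψ w
  rewrite suffixSum-square isStep (drift w) drift w
        | suffixSum-square isStep (ones w) ones w
        | suffixSum-square is1 (drift w) drift w
        | count-steps w
  = expand (zeros w) (ones w) (twos w) (stepDrift w) (stepDrift² w) (stepOnes w) (stepOnes² w) (flatDrift w) (flatDrift² w)
  where
  expand : ∀ z o t A A² B B² E E² → Φ-poly z o t A A² B B² E E²
         + (+ 3 * ((z - t) * (z - t) * (z + t) - + 4 * (z - t) * A + + 4 * A²)
           + + 6 * (o * o * (z + t) - + 4 * o * B + + 4 * B²)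
           + + 6 * ((z - t) * (z - t) * o - + 4 * (z - t) * E + + 4 * E²))
         ≡ Ψ (z + t) o
  expand = solve-∀

nonMono-identity : ∀ w → + 24 * + nonMono w + squares w ≡ Ψ (zeros w + twos w) (ones w)
nonMono-identity w = trans (cong (_+ squares w) (nonMono-formula w)) (Φ+squares≡Ψ w)

nonMono-bound : ∀ w → + 24 * + nonMono w ≤ Ψ (zeros w + twos w) (ones w)
nonMono-bound w = subst (+ 24 * + nonMono w ≤_) (nonMono-identity w)
  (ℤ.i≤i+j (+ 24 * + nonMono w) (squares w) {{nonNegative (squares-nonneg w)}})

-- The extremal words

flats : ℕ → Word → Word
flats zero    w = w
flats (suc l) w = suc zero ∷ flats l w

zigzag : ℕ → Word → Word
zigzag zero    w = w
zigzag (suc j) w = zero ∷ suc (suc zero) ∷ zigzag j w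

suffixSum-flats : ∀ p (g : Word → ℤ) → p (suc zero) ≡ false → ∀ l w → suffixSum p g (flats l w) ≡ suffixSum p g w
suffixSum-flats p g p1≡false zero    w = refl
suffixSum-flats p g p1≡false (suc l) w rewrite p1≡false = suffixSum-flats p g p1≡false l w

drift-flats : ∀ l w → drift (flats l w) ≡ drift w
drift-flats l w = cong₂ _-_ (suffixSum-flats is0 _ refl l w) (suffixSum-flats is2 _ refl l w)

suffixSum-flats-drift : ∀ (h : ℤ → ℤ) l w →
  suffixSum is1 (λ u → h (drift u)) (flats l w) ≡ + l * h (drift w) + suffixSum is1 (λ u → h (drift u)) w
suffixSum-flats-drift h zero    w = sym (ℤ.+-identityˡ _)
suffixSum-flats-drift h (suc l) w =
  trans (cong₂ (λ a b → h a + b) (drift-flats l w) (suffixSum-flats-drift h l w))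
        (absorb (h (drift w)) (+ l) (suffixSum is1 (λ u → h (drift u)) w))
  where
  absorb : ∀ x L S → x + (L * x + S) ≡ (+ 1 + L) * x + S
  absorb = solve-∀

suffixSum-zigzag : ∀ p (g : Word → ℤ) → p zero ≡ false → p (suc (suc zero)) ≡ false →
  ∀ j w → suffixSum p g (zigzag j w) ≡ suffixSum p g w
suffixSum-zigzag p g p0≡false p2≡false zero    w = refl
suffixSum-zigzag p g p0≡false p2≡false (suc j) w rewrite p0≡false | p2≡false =
  suffixSum-zigzag p g p0≡false p2≡false j w

zeros-zigzag : ∀ j w → zeros (zigzag j w) ≡ + j + zeros w
zeros-zigzag zero    w = sym (ℤ.+-identityˡ _)
zeros-zigzag (suc j) w = trans (cong (λ s → + 1 + s) (zeros-zigzag j w)) (sym (ℤ.+-assoc (+ 1) (+ j) (zeros w)))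

twos-zigzag : ∀ j w → twos (zigzag j w) ≡ + j + twos w
twos-zigzag zero    w = sym (ℤ.+-identityˡ _)
twos-zigzag (suc j) w = trans (cong (λ s → + 1 + s) (twos-zigzag j w)) (sym (ℤ.+-assoc (+ 1) (+ j) (twos w)))

drift-up-down : ∀ w → drift (zero ∷ suc (suc zero) ∷ w) ≡ drift w
drift-up-down w = cancel (zeros w) (twos w)
  where
  cancel : ∀ z t → (+ 1 + z) - (+ 1 + t) ≡ z - t
  cancel = solve-∀

drift-down : ∀ w → drift (suc (suc zero) ∷ w) ≡ drift w - + 1
drift-down w = shift (zeros w) (twos w)
  where
  shift : ∀ z t → z - (+ 1 + t) ≡ z - t - + 1
  shift = solve-∀

drift-zigzag : ∀ j w → drift (zigzag j w) ≡ drift w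
drift-zigzag zero    w = refl
drift-zigzag (suc j) w = trans (drift-up-down (zigzag j w)) (drift-zigzag j w)

suffixSum-zigzag-steps : ∀ (G : ℤ → ℤ → ℤ) j w →
  suffixSum isStep (λ u → G (drift u) (ones u)) (zigzag j w)
    ≡ + j * (G (drift w) (ones w) + G (drift w - + 1) (ones w)) + suffixSum isStep (λ u → G (drift u) (ones u)) w
suffixSum-zigzag-steps G zero    w = sym (ℤ.+-identityˡ _)
suffixSum-zigzag-steps G (suc j) w = begin
  G (drift (zero ∷ suc (suc zero) ∷ z)) (ones z) + (G (drift (suc (suc zero) ∷ z)) (ones z) + S z)
    ≡⟨ cong₂ (λ a b → G a (ones z) + (G b (ones z) + S z)) (trans (drift-up-down z) (drift-zigzag j w))
                                                            (trans (drift-down z) (cong (_- + 1) (drift-zigzag j w))) ⟩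
  G (drift w) (ones z) + (G (drift w - + 1) (ones z) + S z)
    ≡⟨ cong₂ (λ o s → G (drift w) o + (G (drift w - + 1) o + s)) (suffixSum-zigzag is1 _ refl refl j w)
                                                                  (suffixSum-zigzag-steps G j w) ⟩
  G (drift w) (ones w) + (G (drift w - + 1) (ones w) + (+ j * (G (drift w) (ones w) + G (drift w - + 1) (ones w)) + S w))
    ≡⟨ absorb (G (drift w) (ones w)) (G (drift w - + 1) (ones w)) (+ j) (S w) ⟩
  + suc j * (G (drift w) (ones w) + G (drift w - + 1) (ones w)) + S w ∎
  where
  z = zigzag j w
  S = suffixSum isStep (λ u → G (drift u) (ones u))
  absorb : ∀ a b J S → a + (b + (J * (a + b) + S)) ≡ (+ 1 + J) * (a + b) + S
  absorb = solve-∀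

construction : ℕ → ℕ → ℕ → Word
construction l j r = flats l (zigzag j (flats r []))

constructionSquares : (L J R D dR dV oR P : ℤ) → ℤ
constructionSquares L J R D dR dV oR P =
    + 3 * (J * ((D - + 2 * dR) * (D - + 2 * dR) + (D - + 2 * (dR - + 1)) * (D - + 2 * (dR - + 1))) + 0ℤ)
  + + 6 * (J * ((P - + 2 * oR) * (P - + 2 * oR) + (P - + 2 * oR) * (P - + 2 * oR)) + 0ℤ)
  + + 6 * (L * ((D - + 2 * dV) * (D - + 2 * dV)) + (R * ((D - + 2 * 0ℤ) * (D - + 2 * 0ℤ)) + 0ℤ))
{-# INLINE constructionSquares #-}

module _ (l j r : ℕ) where

  private
    R V W : Word
    R = flats r []
    V = zigzag j R
    W = flats l V

    drift-R : drift R ≡ 0ℤ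
    drift-R = drift-flats r []

    drift-V : drift V ≡ 0ℤ
    drift-V = trans (drift-zigzag j R) drift-R

    drift-W : drift W ≡ 0ℤ
    drift-W = trans (drift-flats l V) drift-V

    ones-R : ones R ≡ + r
    ones-R = trans (suffixSum-flats-drift (λ _ → + 1) r []) (unit (+ r))
      where
      unit : ∀ x → x * + 1 + 0ℤ ≡ x
      unit = solve-∀

  zeros-construction : zeros W ≡ + j
  zeros-construction =
    trans (suffixSum-flats is0 _ refl l V)
      (trans (zeros-zigzag j R) (trans (cong (λ s → + j + s) (suffixSum-flats is0 _ refl r [])) (ℤ.+-identityʳ (+ j))))

  twos-construction : twos W ≡ + j
  twos-construction =
    trans (suffixSum-flats is2 _ refl l V)
      (trans (twos-zigzag j R) (trans (cong (λ s → + j + s) (suffixSum-flats is2 _ refl r [])) (ℤ.+-identityʳ (+ j))))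

  ones-construction : ones W ≡ + l + + r
  ones-construction =
    trans (suffixSum-flats-drift (λ _ → + 1) l V)
      (cong₂ (λ a b → a + b) (ℤ.*-identityʳ (+ l)) (trans (suffixSum-zigzag is1 _ refl refl j R) ones-R))

  squares-construction : squares W ≡ + 12 * + j * (+ 1 + (+ l - + r) * (+ l - + r))
  squares-construction =
    trans (cong₂ (λ a b → a + + 6 * b) (cong₂ (λ a b → + 3 * a + + 6 * b) steps-drift steps-ones) flats-drift)
          (evaluate drift-W drift-R drift-V ones-R ones-construction)
    where
    D = drift W
    P = ones W
    g₁ g₂ : ℤ → ℤ → ℤ
    g₁ d _ = (D - + 2 * d) * (D - + 2 * d)
    g₂ _ o = (P - + 2 * o) * (P - + 2 * o)
    h₁ : ℤ → ℤ
    h₁ d = (D - + 2 * d) * (D - + 2 * d)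
    steps-drift : suffixSum isStep (λ u → g₁ (drift u) (ones u)) W
                ≡ + j * (g₁ (drift R) (ones R) + g₁ (drift R - + 1) (ones R)) + 0ℤ
    steps-drift = trans (suffixSum-flats isStep _ refl l V)
      (trans (suffixSum-zigzag-steps g₁ j R)
             (cong (λ s → + j * (g₁ (drift R) (ones R) + g₁ (drift R - + 1) (ones R)) + s)
                   (suffixSum-flats isStep _ refl r [])))
    steps-ones : suffixSum isStep (λ u → g₂ (drift u) (ones u)) W
               ≡ + j * (g₂ (drift R) (ones R) + g₂ (drift R - + 1) (ones R)) + 0ℤ
    steps-ones = trans (suffixSum-flats isStep _ refl l V)
      (trans (suffixSum-zigzag-steps g₂ j R)
             (cong (λ s → + j * (g₂ (drift R) (ones R) + g₂ (drift R - + 1) (ones R)) + s)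
                   (suffixSum-flats isStep _ refl r [])))
    flats-drift : suffixSum is1 (λ u → h₁ (drift u)) W ≡ + l * h₁ (drift V) + (+ r * h₁ (drift []) + 0ℤ)
    flats-drift = trans (suffixSum-flats-drift h₁ l V)
      (cong (λ s → + l * h₁ (drift V) + s)
            (trans (suffixSum-zigzag is1 _ refl refl j R) (suffixSum-flats-drift h₁ r [])))
    evaluate : ∀ {D dR dV oR P} → D ≡ 0ℤ → dR ≡ 0ℤ → dV ≡ 0ℤ → oR ≡ + r → P ≡ + l + + r →
      constructionSquares (+ l) (+ j) (+ r) D dR dV oR P ≡ + 12 * + j * (+ 1 + (+ l - + r) * (+ l - + r))
    evaluate refl refl refl refl refl = identity (+ l) (+ j) (+ r)
      where
      identity : ∀ L J R → constructionSquares L J R 0ℤ 0ℤ 0ℤ R (L + R) ≡ + 12 * J * (+ 1 + (L - R) * (L - R))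
      identity = solve-∀

  nonMono-construction : + 24 * + nonMono W ≡ Ψ (+ j + + j) (+ l + + r) - + 12 * + j * (+ 1 + (+ l - + r) * (+ l - + r))
  nonMono-construction = move (begin
    + 24 * + nonMono W + + 12 * + j * (+ 1 + (+ l - + r) * (+ l - + r))
      ≡⟨ cong (λ s → + 24 * + nonMono W + s) (sym squares-construction) ⟩
    + 24 * + nonMono W + squares W
      ≡⟨ nonMono-identity W ⟩
    Ψ (zeros W + twos W) (ones W)
      ≡⟨ cong₂ Ψ (cong₂ _+_ zeros-construction twos-construction) ones-construction ⟩
    Ψ (+ j + + j) (+ l + + r) ∎)
    where
    move : ∀ {x s y} → x + s ≡ y → x ≡ y - s
    move {x} {s} refl = sym (cancel x s)
      where
      cancel : ∀ x s → x + s - s ≡ x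
      cancel = solve-∀

  length-construction : + length W ≡ + j + + j + (+ l + + r)
  length-construction = begin
    + length W                 ≡⟨ length-letters W ⟩
    zeros W + ones W + twos W  ≡⟨ cong₂ _+_ (cong₂ _+_ zeros-construction ones-construction) twos-construction ⟩
    + j + (+ l + + r) + + j    ≡⟨ swap (+ j) (+ l + + r) ⟩
    + j + + j + (+ l + + r)    ∎
    where
    swap : ∀ a b → a + b + a ≡ a + a + b
    swap = solve-∀

nonMono-construction-bound : ∀ l j r → l ≡ r ⊎ l ≡ suc r →
  Ψ (+ j + + j) (+ l + + r) - + 24 * + j ≤ + 24 * + nonMono (construction l j r)
nonMono-construction-bound l j r l≈r =
  subst (Ψ (+ j + + j) (+ l + + r) - + 24 * + j ≤_) (sym (nonMono-construction l j r))
        (ℤ.+-monoʳ-≤ (Ψ (+ j + + j) (+ l + + r)) (ℤ.neg-mono-≤ (ℤ.0≤i-j⇒j≤i (excess l≈r))))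
  where
  excess : l ≡ r ⊎ l ≡ suc r → 0ℤ ≤ + 24 * + j - + 12 * + j * (+ 1 + (+ l - + r) * (+ l - + r))
  excess (inj₁ refl) = subst (0ℤ ≤_) (sym (equal-halves (+ j) (+ r))) (0≤+ 12 ⊗ 0≤+ j)
    where
    equal-halves : ∀ J R → + 24 * J - + 12 * J * (+ 1 + (R - R) * (R - R)) ≡ + 12 * J
    equal-halves = solve-∀
  excess (inj₂ refl) = subst (0ℤ ≤_) (sym (unequal-halves (+ j) (+ r))) (0≤+ 0)
    where
    unequal-halves : ∀ J R → + 24 * J - + 12 * J * (+ 1 + (+ 1 + R - R) * (+ 1 + R - R)) ≡ 0ℤ
    unequal-halves = solve-∀

⌈n/2⌉≈⌊n/2⌋ : ∀ n → ⌈ n /2⌉ ≡ ⌊ n /2⌋ ⊎ ⌈ n /2⌉ ≡ suc ⌊ n /2⌋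
⌈n/2⌉≈⌊n/2⌋ zero          = inj₁ refl
⌈n/2⌉≈⌊n/2⌋ (suc zero)    = inj₂ refl
⌈n/2⌉≈⌊n/2⌋ (suc (suc n)) = Sum.map (cong suc) (cong suc) (⌈n/2⌉≈⌊n/2⌋ n)

balanced : ℕ → ℕ → Word
balanced j p = construction ⌈ p /2⌉ j ⌊ p /2⌋

private
  halves : ∀ p → + ⌈ p /2⌉ + + ⌊ p /2⌋ ≡ + p
  halves p = cong +_ (trans (ℕ.+-comm ⌈ p /2⌉ ⌊ p /2⌋) (ℕ.⌊n/2⌋+⌈n/2⌉≡n p))

length-balanced : ∀ j p → length (balanced j p) ≡ j ℕ.+ j ℕ.+ p
length-balanced j p =
  ℤ.+-injective (trans (length-construction ⌈ p /2⌉ j ⌊ p /2⌋) (cong (λ s → + j + + j + s) (halves p)))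

nonMono-balanced : ∀ j p → Ψ (+ j + + j) (+ p) - + 24 * + j ≤ + 24 * + nonMono (balanced j p)
nonMono-balanced j p =
  subst (λ s → Ψ (+ j + + j) s - + 24 * + j ≤ + 24 * + nonMono (balanced j p)) (halves p)
        (nonMono-construction-bound ⌈ p /2⌉ j ⌊ p /2⌋ (⌈n/2⌉≈⌊n/2⌋ p))

-- Polynomial inequalities

-- Its minimum over j ≥ 0 is 4(T − √2·U)·n³, attained at j = √2·n.
cubic-nonneg : ∀ U T j n → 0ℤ ≤ U - + 1 → 0ℤ ≤ T → 0ℤ ≤ T * T - + 2 * U * U → 0ℤ ≤ j → 0ℤ ≤ n →
  0ℤ ≤ U * j * j * j - + 6 * U * j * n * n + + 4 * T * n * n * n
cubic-nonneg U T j n hU hT hTU hj hn with ℤ.≤-total (+ 2 * T * n) (+ 3 * U * j)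
... | inj₁ 2Tn≤3Uj = nonneg-cancel {U * U} (pos-* {U} {U} hU hU) (subst (0ℤ ≤_) (identity U T j n)
        (square-nonneg (U * j - T * n) ⊗ (0≤-of-pos {U} hU ⊗ hj ⊕ 0≤+ 2 ⊗ hT ⊗ hn)
         ⊕ hTU ⊗ 0≤-of-≤ 2Tn≤3Uj ⊗ (hn ⊗ hn)))
  where
  identity : ∀ U T j n →
      (U * j - T * n) * (U * j - T * n) * (U * j + + 2 * T * n) + (T * T - + 2 * U * U) * (+ 3 * U * j - + 2 * T * n) * (n * n)
    ≡ U * U * (U * j * j * j - + 6 * U * j * n * n + + 4 * T * n * n * n)
  identity = solve-∀
... | inj₂ 3Uj≤2Tn = subst (0ℤ ≤_) (identity U T j n)
        (0≤-of-pos {U} hU ⊗ hj ⊗ hj ⊗ hj ⊕ 0≤+ 2 ⊗ (hn ⊗ hn) ⊗ 0≤-of-≤ 3Uj≤2Tn)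
  where
  identity : ∀ U T j n → U * j * j * j + + 2 * (n * n) * (+ 2 * T * n - + 3 * U * j)
                       ≡ U * j * j * j - + 6 * U * j * n * n + + 4 * T * n * n * n
  identity = solve-∀

≤-of-square-gap : ∀ {P D} → 0ℤ ≤ P → 0ℤ ≤ D → 0ℤ ≤ P * P - + 2 * D * D - + 1 → 0ℤ ≤ P - D
≤-of-square-gap {P} {D} hP hD hE with ℤ.≤-total D P
... | inj₁ D≤P = 0≤-of-≤ D≤P
... | inj₂ P≤D = ⊥-elim (contradiction (subst (0ℤ ≤_) (identity P D) (gap ⊗ (gap ⊕ hP ⊕ hP) ⊕ hE ⊕ square-nonneg D)))
  where
  gap = 0≤-of-≤ P≤D
  identity : ∀ P D → (D - P) * (D - P + P + P) + (P * P - + 2 * D * D - + 1) + D * D ≡ -[1+ 0 ]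
  identity = solve-∀
  contradiction : 0ℤ ≤ -[1+ 0 ] → ⊥
  contradiction ()

lower-polynomial : ∀ P D k p → + 1 ≤ P → + 1 ≤ D → + 2 * D * D < P * P → 0ℤ ≤ k → 0ℤ ≤ p →
  + 6 * P * P + P * D < k + p →
  D * Ψ k p < + 4 * (P - D) * ((k + p) * (k + p - + 1) * (k + p - + 2))
lower-polynomial P D k p 1≤P 1≤D 2D²<P² hk hp large =
  <-of-0≤ (pos-cancel {+ 2 * P} (pos-* {+ 2} {P} (0≤+ 1) hP) (subst (0ℤ ≤_) (identity P D k p) certificate))
  where
  hP = 0≤-of-≤ 1≤P
  hD = 0≤-of-≤ 1≤D
  hE = 0≤-of-< 2D²<P²
  hN = 0≤-of-< large
  nP = 0≤-of-pos {P} hP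
  nD = 0≤-of-pos {D} hD
  nn = hk ⊕ hp
  hn1 : 0ℤ ≤ k + p - + 1
  hn1 = subst (0ℤ ≤_) (shift (k + p) P D) (hN ⊕ (0≤+ 6 ⊗ nP ⊗ nP ⊕ nP ⊗ nD))
    where
    shift : ∀ n P D → n - (+ 6 * P * P + P * D) - + 1 + (+ 6 * P * P + P * D) ≡ n - + 1
    shift = solve-∀
  hU : 0ℤ ≤ + 2 * P * D - + 1
  hU = pos-* {+ 2 * P} {D} (pos-* {+ 2} {P} (0≤+ 1) hP) hD
  hTU : 0ℤ ≤ (P * P + + 2 * D * D) * (P * P + + 2 * D * D) - + 2 * (+ 2 * P * D) * (+ 2 * P * D)
  hTU = subst (0ℤ ≤_) (gap P D) (square-nonneg (P * P - + 2 * D * D))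
    where
    gap : ∀ P D → (P * P - + 2 * D * D) * (P * P - + 2 * D * D)
                ≡ (P * P + + 2 * D * D) * (P * P + + 2 * D * D) - + 2 * (+ 2 * P * D) * (+ 2 * P * D)
    gap = solve-∀
  certificate =
      cubic-nonneg (+ 2 * P * D) (P * P + + 2 * D * D) (k + + 2 * p) (k + p)
                   hU (square-nonneg P ⊕ 0≤+ 2 ⊗ nD ⊗ nD) hTU (hk ⊕ 0≤+ 2 ⊗ hp) nn
    ⊕ 0≤+ 4 ⊗ hE ⊗ nn ⊗ nn ⊗ nn
    ⊕ 0≤+ 4 ⊗ nP ⊗ nD ⊗ nn ⊗ hn1
    ⊕ 0≤+ 4 ⊗ nn ⊗ nn ⊗ hN
    ⊕ (0≤+ 4 ⊗ hn1 ⊗ hn1 ⊕ 0≤+ 8 ⊗ hn1 ⊕ 0≤+ 3)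
    ⊕ 0≤+ 2 ⊗ nP ⊗ (0≤+ 12 ⊗ nD ⊗ nn ⊗ nn ⊕ 0≤+ 8 ⊗ ≤-of-square-gap nP nD hE ⊗ nn ⊕ 0≤+ 2 ⊗ nD ⊗ hp)
  identity : ∀ P D k p → let n = k + p ; j = k + + 2 * p ; U = + 2 * P * D ; T = P * P + + 2 * D * D in
      U * j * j * j - + 6 * U * j * n * n + + 4 * T * n * n * n
    + + 4 * (P * P - + 2 * D * D - + 1) * n * n * n
    + + 4 * P * D * n * (n - + 1)
    + + 4 * n * n * (n - (+ 6 * P * P + P * D) - + 1)
    + (+ 4 * (n - + 1) * (n - + 1) + + 8 * (n - + 1) + + 3)
    + + 2 * P * (+ 12 * D * n * n + + 8 * (P - D) * n + + 2 * D * p)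
    ≡ + 2 * P * (+ 4 * (P - D) * (n * (n - + 1) * (n - + 2)) - D * Ψ k p) - + 1
  identity = solve-∀

upper-polynomial : ∀ B D k p → + 1 ≤ D → B < D → (+ 2 * D - B) * (+ 2 * D - B) < + 2 * D * D →
  0ℤ ≤ k → 0ℤ ≤ p → + 48 * D * D * D < k + p → 0ℤ ≤ B * (k + p) - D * k → B * (k + p) - D * k < + 2 * D →
  + 4 * (D - B) * ((k + p) * (k + p - + 1) * (k + p - + 2)) < D * (Ψ k p - + 12 * k)
upper-polynomial B D k p 1≤D B<D gap hk hp large he e<2D =
  <-of-0≤ (pos-cancel {D * D} (pos-* {D} {D} hD hD) (subst (0ℤ ≤_) (identity B D k p) certificate))
  where
  hD = 0≤-of-≤ 1≤D
  nD = 0≤-of-pos {D} hD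
  hDB1 = 0≤-of-< B<D
  hDB = 0≤-of-pos {D - B} hDB1
  hN = 0≤-of-< large
  nn = hk ⊕ hp
  h2De = 0≤-of-pos {+ 2 * D - (B * (k + p) - D * k)} (0≤-of-< e<2D)
  hn1 : 0ℤ ≤ k + p - + 1
  hn1 = subst (0ℤ ≤_) (shift (k + p) D) (hN ⊕ 0≤+ 48 ⊗ nD ⊗ nD ⊗ nD)
    where
    shift : ∀ n D → n - + 48 * D * D * D - + 1 + + 48 * D * D * D ≡ n - + 1
    shift = solve-∀
  h2D-B : 0ℤ ≤ + 2 * D - B - + 1
  h2D-B = subst (0ℤ ≤_) (shift B D) (hDB1 ⊕ nD)
    where
    shift : ∀ B D → D - B - + 1 + D ≡ + 2 * D - B - + 1
    shift = solve-∀
  hGap = pos-* {+ 2 * D - B} {+ 2 * D * D - (+ 2 * D - B) * (+ 2 * D - B)} h2D-B (0≤-of-< gap)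
  certificate =
      nn ⊗ nn ⊗ nn ⊗ hGap
    ⊕ nn ⊗ nn ⊗ hN
    ⊕ hn1 ⊗ (nn ⊕ 0≤+ 1)
    ⊕ 0≤+ 2 ⊗ nD ⊗ nD ⊗ nD ⊗ hn1 ⊗ (0≤+ 10 ⊗ nn ⊕ 0≤+ 4)
    ⊕ 0≤+ 10 ⊗ nD ⊗ nD ⊗ nD ⊗ (nn ⊗ hn1 ⊕ hp)
    ⊕ h2De ⊗ (0≤+ 3 ⊗ nD ⊗ nD ⊗ nn ⊗ nn ⊕ 0≤+ 6 ⊗ nD ⊗ nD ⊗ nn ⊕ 0≤+ 4 ⊗ nD ⊗ nD ⊕ 0≤+ 6 ⊗ nn ⊗ nn ⊗ nD ⊗ nD)
    ⊕ he ⊗ (0≤+ 3 ⊗ nD ⊗ nD ⊗ hp ⊗ (nn ⊕ hk) ⊕ 0≤+ 3 ⊗ nD ⊗ (hp ⊗ (0≤+ 2 ⊗ nD) ⊕ hk ⊗ h2De) ⊕ h2De ⊗ (0≤+ 2 ⊗ nD ⊕ he))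
    ⊕ he ⊗ (0≤+ 12 ⊗ nn ⊗ nD ⊗ nD ⊗ hk ⊕ 0≤+ 6 ⊗ nn ⊗ nD ⊗ he)
    ⊕ 0≤+ 4 ⊗ hDB ⊗ nD ⊗ nD ⊗ nn ⊗ (0≤+ 3 ⊗ hn1 ⊕ 0≤+ 1)
  identity : ∀ B D k p → let n = k + p ; e = B * n - D * k in
      n * n * n * ((+ 2 * D - B) * (+ 2 * D * D - (+ 2 * D - B) * (+ 2 * D - B)) - + 1)
    + n * n * (n - + 48 * D * D * D - + 1)
    + (n - + 1) * (n + + 1)
    + + 2 * D * D * D * (n - + 1) * (+ 10 * n + + 4)
    + + 10 * D * D * D * (n * (n - + 1) + p)
    + (+ 2 * D - e) * (+ 3 * D * D * n * n + + 6 * D * D * n + + 4 * D * D + + 6 * n * n * D * D)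
    + e * (+ 3 * D * D * p * (n + k) + + 3 * D * (p * (+ 2 * D) + k * (+ 2 * D - e)) + (+ 2 * D - e) * (+ 2 * D + e))
    + e * (+ 12 * n * D * D * k + + 6 * n * D * e)
    + + 4 * (D - B) * D * D * n * (+ 3 * (n - + 1) + + 1)
    ≡ D * D * (D * (Ψ k p - + 12 * k) - + 4 * (D - B) * (n * (n - + 1) * (n - + 2))) - + 1
  identity = solve-∀

choose-2 : ∀ n → + 2 * + (n C 2) ≡ + n * (+ n - + 1)
choose-2 zero    = refl
choose-2 (suc n) = begin
  + 2 * + (suc n C 2)             ≡⟨ cong (λ c → + 2 * + c) (sym (nCk+nC[k+1]≡[n+1]C[k+1] n 1)) ⟩
  + 2 * + (n C 1 ℕ.+ n C 2)       ≡⟨ pos-*-+ 2 (n C 1) (n C 2) ⟩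
  + 2 * + (n C 1) + + 2 * + (n C 2) ≡⟨ cong₂ (λ a b → + 2 * + a + b) (nC1≡n n) (choose-2 n) ⟩
  + 2 * + n + + n * (+ n - + 1)   ≡⟨ step (+ n) ⟩
  + suc n * (+ suc n - + 1)       ∎
  where
  step : ∀ x → + 2 * x + x * (x - + 1) ≡ (+ 1 + x) * (+ 1 + x - + 1)
  step = solve-∀

choose-3 : ∀ n → + 6 * + (n C 3) ≡ + n * (+ n - + 1) * (+ n - + 2)
choose-3 zero    = refl
choose-3 (suc n) = begin
  + 6 * + (suc n C 3)                          ≡⟨ cong (λ c → + 6 * + c) (sym (nCk+nC[k+1]≡[n+1]C[k+1] n 2)) ⟩
  + 6 * + (n C 2 ℕ.+ n C 3)                    ≡⟨ pos-*-+ 6 (n C 2) (n C 3) ⟩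
  + 6 * + (n C 2) + + 6 * + (n C 3)            ≡⟨ cong (_+ + 6 * + (n C 3)) (ℤ.*-assoc (+ 3) (+ 2) (+ (n C 2))) ⟩
  + 3 * (+ 2 * + (n C 2)) + + 6 * + (n C 3)    ≡⟨ cong₂ (λ a b → + 3 * a + b) (choose-2 n) (choose-3 n) ⟩
  + 3 * (+ n * (+ n - + 1)) + + n * (+ n - + 1) * (+ n - + 2) ≡⟨ step (+ n) ⟩
  + suc n * (+ suc n - + 1) * (+ suc n - + 2)  ∎
  where
  step : ∀ x → + 3 * (x * (x - + 1)) + x * (x - + 1) * (x - + 2) ≡ (+ 1 + x) * (+ 1 + x - + 1) * (+ 1 + x - + 2)
  step = solve-∀

choose-3-pos : ∀ {n} → 3 ℕ.≤ n → 1 ℕ.≤ n C 3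
choose-3-pos {n} 3≤n = subst (λ x → 1 ℕ.≤ x C 3) (ℕ.m+[n∸m]≡n 3≤n) (from-3 (n ℕ.∸ 3))
  where
  from-3 : ∀ t → 1 ℕ.≤ (3 ℕ.+ t) C 3
  from-3 zero    = s≤s z≤n
  from-3 (suc t) = subst (1 ℕ.≤_) (nCk+nC[k+1]≡[n+1]C[k+1] (3 ℕ.+ t) 2) (ℕ.≤-trans (from-3 t) (ℕ.m≤n+m _ _))

allWords-length : ∀ n → All (λ w → length w ≡ n) (allWords 3 n)
allWords-length zero    = refl ∷ []
allWords-length (suc n) =
  concat⁺ (map⁺ (All.map (λ e → cong suc e ∷ cong suc e ∷ cong suc e ∷ []) (allWords-length n)))

∈-allWords : ∀ (w : Word) → w ∈ allWords 3 (length w)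
∈-allWords []      = here refl
∈-allWords (x ∷ w) = ∈-concat⁺′ (head x) (∈-map⁺ (λ v → map (_∷ v) (allFin 3)) (∈-allWords w))
  where
  head : ∀ x → (x ∷ w) ∈ map (_∷ w) (allFin 3)
  head zero             = here refl
  head (suc zero)       = there (here refl)
  head (suc (suc zero)) = there (there (here refl))

foldr-⊓-≤ : ∀ c xs {x} → x ∈ xs → foldr _⊓_ c xs ℕ.≤ x
foldr-⊓-≤ c (y ∷ ys) (here refl) = ℕ.m⊓n≤m y _
foldr-⊓-≤ c (y ∷ ys) (there x∈)  = ℕ.≤-trans (ℕ.m⊓n≤n y _) (foldr-⊓-≤ c ys x∈)

foldr-⊓-sel : ∀ c xs → foldr _⊓_ c xs ≡ c ⊎ ∃ λ x → x ∈ xs × foldr _⊓_ c xs ≡ x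
foldr-⊓-sel c []       = inj₁ refl
foldr-⊓-sel c (y ∷ ys) with ℕ.⊓-sel y (foldr _⊓_ c ys)
... | inj₁ e = inj₂ (y , here refl , e)
... | inj₂ e with foldr-⊓-sel c ys
...   | inj₁ e′            = inj₁ (trans e e′)
...   | inj₂ (x , x∈ , e′) = inj₂ (x , there x∈ , trans e e′)

minMono-≤ : ∀ w → minMono 3 3 (length w) ℕ.≤ m 3 w
minMono-≤ w = foldr-⊓-≤ (length w C 3) (map (m 3) (allWords 3 (length w))) (∈-map⁺ (m 3) (∈-allWords w))

m≤C : ∀ w → m 3 w ℕ.≤ length w C 3
m≤C w = subst (m 3 w ℕ.≤_) (m+nonMono≡C w) (ℕ.m≤m+n (m 3 w) (nonMono w))

-- The seed n C 3 of the fold is itself a value of m (at any word), so the minimum is attained.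
minMono-attained : ∀ n → ∃ λ w → length w ≡ n × minMono 3 3 n ≡ m 3 w
minMono-attained n with foldr-⊓-sel (n C 3) (map (m 3) (allWords 3 n))
... | inj₂ (x , x∈ , e) with ∈-map⁻ (m 3) x∈
...   | w , w∈ , x≡m = w , All.lookup (allWords-length n) w∈ , trans e x≡m
minMono-attained n | inj₁ e = w₀ , length-replicate n , ℕ.≤-antisym min≤m m≤min
  where
  w₀ = replicate n zero
  min≤m : minMono 3 3 n ℕ.≤ m 3 w₀
  min≤m = subst (λ l → minMono 3 3 l ℕ.≤ m 3 w₀) (length-replicate n) (minMono-≤ w₀)
  m≤min : m 3 w₀ ℕ.≤ minMono 3 3 n
  m≤min = subst (m 3 w₀ ℕ.≤_) (sym e) (subst (λ l → m 3 w₀ ℕ.≤ l C 3) (length-replicate n) (m≤C w₀))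

m-as-difference : ∀ w → + m 3 w ≡ + (length w C 3) - + nonMono w
m-as-difference w =
  trans (cancel (+ m 3 w) (+ nonMono w))
        (cong (_- + nonMono w) (trans (sym (ℤ.pos-+ (m 3 w) (nonMono w))) (cong +_ (m+nonMono≡C w))))
  where
  cancel : ∀ x y → x ≡ x + y - y
  cancel = solve-∀

length≡steps+ones : ∀ w → + length w ≡ zeros w + twos w + ones w
length≡steps+ones w = trans (length-letters w) (swap (zeros w) (ones w) (twos w))
  where
  swap : ∀ z o t → z + o + t ≡ z + t + o
  swap = solve-∀

six-C : ∀ w → let n = zeros w + twos w + ones w in + 6 * + (length w C 3) ≡ n * (n - + 1) * (n - + 2)
six-C w = trans (choose-3 (length w)) (cong (λ x → x * (x - + 1) * (x - + 2)) (length≡steps+ones w))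

m-lower : ∀ P D w → + 1 ≤ P → + 1 ≤ D → + 2 * D * D < P * P → + 6 * P * P + P * D < + length w →
  (+ 2 * D - P) * + (length w C 3) < D * + m 3 w
m-lower P D w 1≤P 1≤D gap large =
  subst (λ x → (+ 2 * D - P) * C′ < D * x) (sym (m-as-difference w))
    (<-of-0≤ (pos-cancel {+ 24} {D * (C′ - + nonMono w) - (+ 2 * D - P) * C′} (0≤+ 23) (subst (0ℤ ≤_) (identity P D C′ (+ nonMono w) (Ψ k p))
      (poly ⊕ 0≤-of-pos {D} (0≤-of-≤ 1≤D) ⊗ 0≤-of-≤ (nonMono-bound w)))))
  where
  k = zeros w + twos w
  p = ones w
  C′ = + (length w C 3)
  hk : 0ℤ ≤ k
  hk = suffixSum-nonneg is0 (λ _ → 0≤+ 1) w ⊕ suffixSum-nonneg is2 (λ _ → 0≤+ 1) w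
  poly : 0ℤ ≤ + 4 * (P - D) * (+ 6 * C′) - D * Ψ k p - + 1
  poly = subst (λ X → 0ℤ ≤ + 4 * (P - D) * X - D * Ψ k p - + 1) (sym (six-C w))
    (0≤-of-< (lower-polynomial P D k p 1≤P 1≤D gap hk (suffixSum-nonneg is1 (λ _ → 0≤+ 1) w)
                               (subst (+ 6 * P * P + P * D <_) (length≡steps+ones w) large)))
  identity : ∀ P D c N S → + 4 * (P - D) * (+ 6 * c) - D * S - + 1 + D * (S - + 24 * N)
                         ≡ + 24 * (D * (c - N) - (+ 2 * D - P) * c) - + 1
  identity = solve-∀

minMono-lower : ∀ P D n → + 1 ≤ P → + 1 ≤ D → + 2 * D * D < P * P → + 6 * P * P + P * D < + n →
  (+ 2 * D - P) * + (n C 3) < D * + minMono 3 3 n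
minMono-lower P D n 1≤P 1≤D gap large with minMono-attained n
... | w , refl , min≡m = subst (λ x → (+ 2 * D - P) * + (length w C 3) < D * + x) (sym min≡m) (m-lower P D w 1≤P 1≤D gap large)

m-upper : ∀ B D j p → + 1 ≤ D → B < D → (+ 2 * D - B) * (+ 2 * D - B) < + 2 * D * D →
  + 48 * D * D * D < + j + + j + + p → 0ℤ ≤ B * (+ j + + j + + p) - D * (+ j + + j) →
  B * (+ j + + j + + p) - D * (+ j + + j) < + 2 * D →
  D * + m 3 (balanced j p) < B * + ((j ℕ.+ j ℕ.+ p) C 3)
m-upper B D j p 1≤D B<D gap large he e<2D =
  subst (λ l → D * + m 3 W < B * + (l C 3)) (length-balanced j p)
  (subst (λ x → D * x < B * C′) (sym (m-as-difference W))
    (<-of-0≤ (pos-cancel {+ 24} {B * C′ - D * (C′ - N)} (0≤+ 23) (subst (0ℤ ≤_) (identity B D C′ N (+ j) S)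
      (poly ⊕ 0≤-of-pos {D} (0≤-of-≤ 1≤D) ⊗ 0≤-of-≤ (nonMono-balanced j p))))))
  where
  W = balanced j p
  C′ = + (length W C 3)
  N = + nonMono W
  S = Ψ (+ j + + j) (+ p)
  six-C′ : + 6 * C′ ≡ (+ j + + j + + p) * (+ j + + j + + p - + 1) * (+ j + + j + + p - + 2)
  six-C′ = trans (cong (λ l → + 6 * + (l C 3)) (length-balanced j p)) (choose-3 (j ℕ.+ j ℕ.+ p))
  poly : 0ℤ ≤ D * (S - + 12 * (+ j + + j)) - + 4 * (D - B) * (+ 6 * C′) - + 1
  poly = subst (λ X → 0ℤ ≤ D * (S - + 12 * (+ j + + j)) - + 4 * (D - B) * X - + 1) (sym six-C′)
    (0≤-of-< (upper-polynomial B D (+ j + + j) (+ p) 1≤D B<D gap (0≤+ (j ℕ.+ j)) (0≤+ p) large he e<2D))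
  identity : ∀ B D c N J S → D * (S - + 12 * (J + J)) - + 4 * (D - B) * (+ 6 * c) - + 1 + D * (+ 24 * N - (S - + 24 * J))
                           ≡ + 24 * (B * c - D * (c - N)) - + 1
  identity = solve-∀

nonneg-of-gap : ∀ B D → 0ℤ ≤ D → (+ 2 * D - B) * (+ 2 * D - B) < + 2 * D * D → 0ℤ ≤ B
nonneg-of-gap B D hD gap with ℤ.≤-total 0ℤ B
... | inj₁ 0≤B = 0≤B
... | inj₂ B≤0 = ⊥-elim (impossible (subst (0ℤ ≤_) (identity B D)
                   (0≤-of-< gap ⊕ ℤ.neg-mono-≤ B≤0 ⊗ (0≤+ 4 ⊗ hD ⊕ ℤ.neg-mono-≤ B≤0) ⊕ 0≤+ 2 ⊗ hD ⊗ hD)))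
  where
  identity : ∀ B D → + 2 * D * D - (+ 2 * D - B) * (+ 2 * D - B) - + 1 + (- B) * (+ 4 * D + (- B)) + + 2 * D * D ≡ -[1+ 0 ]
  identity = solve-∀
  impossible : 0ℤ ≤ -[1+ 0 ] → ⊥
  impossible ()

even-division : ∀ b d n → ∃ λ j → ∃ λ e → e ℕ.< 2 ℕ.* suc d × + b * + n - + suc d * (+ j + + j) ≡ + e
even-division b d n = j , e , m%n<n (b ℕ.* n) (2 ℕ.* suc d) , rearrange (+ e) (+ j) (+ suc d) bn≡
  where
  j = (b ℕ.* n) / (2 ℕ.* suc d)
  e = (b ℕ.* n) % (2 ℕ.* suc d)
  bn≡ : + b * + n ≡ + e + + j * (+ 2 * + suc d)
  bn≡ = begin
    + b * + n                       ≡⟨ sym (ℤ.pos-* b n) ⟩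
    + (b ℕ.* n)                     ≡⟨ cong +_ (m≡m%n+[m/n]*n (b ℕ.* n) (2 ℕ.* suc d)) ⟩
    + (e ℕ.+ j ℕ.* (2 ℕ.* suc d))   ≡⟨ ℤ.pos-+ e (j ℕ.* (2 ℕ.* suc d)) ⟩
    + e + + (j ℕ.* (2 ℕ.* suc d))   ≡⟨ cong (λ x → + e + x) (ℤ.pos-* j (2 ℕ.* suc d)) ⟩
    + e + + j * (+ 2 * + suc d)     ∎
  rearrange : ∀ {X} E J D → X ≡ E + J * (+ 2 * D) → X - D * (J + J) ≡ E
  rearrange E J D refl = cancel E J D
    where
    cancel : ∀ E J D → E + J * (+ 2 * D) - D * (J + J) ≡ E
    cancel = solve-∀

minMono-upper : ∀ B d n → B < + suc d → (+ 2 * + suc d - B) * (+ 2 * + suc d - B) < + 2 * + suc d * + suc d →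
  + 48 * + suc d * + suc d * + suc d < + n → + suc d * + minMono 3 3 n < B * + (n C 3)
minMono-upper B d n B<D gap large with even-division ∣ B ∣ d n
... | j , e , e<2D , balance =
  subst (λ l → D * + minMono 3 3 l < B * + (l C 3)) j+j+p≡n
    (ℤ.≤-<-trans (ℤ.*-monoˡ-≤-nonNeg D (+≤+ min≤m)) (m-upper B D j p (+≤+ (s≤s z≤n)) B<D gap large′ he′ e<2D′))
  where
  D = + suc d
  balance′ : B * + n - D * (+ j + + j) ≡ + e
  balance′ = subst (λ x → x * + n - D * (+ j + + j) ≡ + e) (ℤ.0≤i⇒+∣i∣≡i (nonneg-of-gap B D (0≤+ (suc d)) gap)) balance
  2j≤n : j ℕ.+ j ℕ.≤ n
  2j≤n = ℤ.drop‿+≤+ (ℤ.0≤i-j⇒j≤i (nonneg-cancel {D} (0≤+ d) (subst (0ℤ ≤_) (identity B D (+ n) (+ j + + j))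
           (0≤-of-≤ (ℤ.<⇒≤ B<D) ⊗ 0≤+ n ⊕ subst (0ℤ ≤_) (sym balance′) (0≤+ e)))))
    where
    identity : ∀ B D N K → (D - B) * N + (B * N - D * K) ≡ D * (N - K)
    identity = solve-∀
  p = n ℕ.∸ (j ℕ.+ j)
  j+j+p≡n : j ℕ.+ j ℕ.+ p ≡ n
  j+j+p≡n = ℕ.m+[n∸m]≡n 2j≤n
  large′ : + 48 * D * D * D < + j + + j + + p
  large′ = subst (λ l → + 48 * D * D * D < + l) (sym j+j+p≡n) large
  he′ : 0ℤ ≤ B * (+ j + + j + + p) - D * (+ j + + j)
  he′ = subst (λ l → 0ℤ ≤ B * + l - D * (+ j + + j)) (sym j+j+p≡n) (subst (0ℤ ≤_) (sym balance′) (0≤+ e))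
  e<2D′ : B * (+ j + + j + + p) - D * (+ j + + j) < + 2 * D
  e<2D′ = subst (λ l → B * + l - D * (+ j + + j) < + 2 * D) (sym j+j+p≡n) (subst (_< + 2 * D) (sym balance′) (+<+ e<2D))
  min≤m : minMono 3 3 (j ℕ.+ j ℕ.+ p) ℕ.≤ m 3 (balanced j p)
  min≤m = subst (λ l → minMono 3 3 l ℕ.≤ m 3 (balanced j p)) (length-balanced j p) (minMono-≤ (balanced j p))

-- Comparison with 2 - √2

Eventually : (ℕ → Set) → Set
Eventually P = ∃ λ N → ∀ n → N ℕ.≤ n → P n

eventually-map : ∀ {P Q : ℕ → Set} → (∀ n → P n → Q n) → Eventually P → Eventually Q
eventually-map f (N , p) = N , λ n N≤n → f n (p n N≤n)

eventually-× : ∀ {P Q : ℕ → Set} → Eventually P → Eventually Q → Eventually (λ n → P n × Q n)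
eventually-× (M , p) (N , q) =
  M ℕ.⊔ N , λ n h → p n (ℕ.≤-trans (ℕ.m≤m⊔n M N) h) , q n (ℕ.≤-trans (ℕ.m≤n⊔m M N) h)

eventually-≥ : ∀ N → Eventually (N ℕ.≤_)
eventually-≥ N = N , λ _ N≤n → N≤n

eventually-> : ∀ X → Eventually (λ n → X < + n)
eventually-> X = suc ∣ X ∣ , λ _ h → ℤ.≤-<-trans (≤-abs X) (+<+ h)
  where
  ≤-abs : ∀ i → i ≤ + ∣ i ∣
  ≤-abs (+ n)    = ℤ.≤-refl
  ≤-abs -[1+ n ] = -≤+

ratio-above : ∀ q M c → 1 ℕ.≤ c → ↥ q * + c < + M * ↧ q → q ℚ.< ratio M c
ratio-above q@(ℚ.mkℚ _ _ _) M (suc c) _ h =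
  ℚ.toℚᵘ-cancel-< (ℚᵘ.<-respʳ-≃ (ℚᵘ.≃-sym (ℚ.toℚᵘ-fromℚᵘ (ℚᵘ.mkℚᵘ (+ M) c))) (ℚᵘ.*<* h))

ratio-below : ∀ q M c → 1 ℕ.≤ c → + M * ↧ q < ↥ q * + c → ratio M c ℚ.< q
ratio-below q@(ℚ.mkℚ _ _ _) M (suc c) _ h =
  ℚ.toℚᵘ-cancel-< (ℚᵘ.<-respˡ-≃ (ℚᵘ.≃-sym (ℚ.toℚᵘ-fromℚᵘ (ℚᵘ.mkℚᵘ (+ M) c))) (ℚᵘ.*<* h))

private
  toℚᵘ-square : ∀ q → ℚ.toℚᵘ ((two ℚ.- q) ℚ.* (two ℚ.- q))
                      ℚᵘ.≃ (ℚ.toℚᵘ two ℚᵘ.- ℚ.toℚᵘ q) ℚᵘ.* (ℚ.toℚᵘ two ℚᵘ.- ℚ.toℚᵘ q)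
  toℚᵘ-square q = ℚᵘ.≃-trans (ℚ.toℚᵘ-homo-* (two ℚ.- q) (two ℚ.- q)) (ℚᵘ.*-cong difference difference)
    where
    difference = ℚᵘ.≃-trans (ℚ.toℚᵘ-homo-+ two (ℚ.- q)) (ℚᵘ.+-congʳ (ℚ.toℚᵘ two) (ℚ.toℚᵘ-homo‿- q))

  -- The unnormalised numerators that ℚᵘ arithmetic produces for (2 - q)² and 2.
  square-form : ∀ A D → ((+ 2 * D + (- A) * + 1) * (+ 2 * D + (- A) * + 1)) * + 1 ≡ (+ 2 * D - A) * (+ 2 * D - A)
  square-form = solve-∀

  two-form : ∀ D → + 2 * ((+ 1 * D) * (+ 1 * D)) ≡ + 2 * D * D
  two-form = solve-∀

below-target : ∀ a → BelowTarget a →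
  ↥ a < + 2 * ↧ a × + 2 * ↧ a * ↧ a < (+ 2 * ↧ a - ↥ a) * (+ 2 * ↧ a - ↥ a)
below-target a@(ℚ.mkℚ A d _) (a<2 , 2<square) =
  subst (_< + 2 * ↧ a) (ℤ.*-identityʳ A) (ℚ.drop-*<* a<2) ,
  subst₂ _<_ (two-form (↧ a)) (square-form A (↧ a))
    (ℚᵘ.drop-*<* (ℚᵘ.<-respʳ-≃ (toℚᵘ-square a) (ℚ.toℚᵘ-mono-< 2<square)))

above-target : ∀ b → b ℚ.< 1ℚ → (two ℚ.- b) ℚ.* (two ℚ.- b) ℚ.< two →
  ↥ b < ↧ b × (+ 2 * ↧ b - ↥ b) * (+ 2 * ↧ b - ↥ b) < + 2 * ↧ b * ↧ b
above-target b@(ℚ.mkℚ B d _) b<1 square<2 =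
  subst₂ _<_ (ℤ.*-identityʳ B) (ℤ.*-identityˡ (↧ b)) (ℚ.drop-*<* b<1) ,
  subst₂ _<_ (square-form B (↧ b)) (two-form (↧ b))
    (ℚᵘ.drop-*<* (ℚᵘ.<-respˡ-≃ (toℚᵘ-square b) (ℚ.toℚᵘ-mono-< square<2)))

f-eventually-above : ∀ a → BelowTarget a → Eventually (λ n → a ℚ.< f 3 3 n)
f-eventually-above a@(ℚ.mkℚ A d _) below =
  eventually-map bound (eventually-× (eventually-> (+ 6 * P * P + P * D)) (eventually-≥ 3))
  where
  D = + suc d
  P = + 2 * D - A
  bound : ∀ n → + 6 * P * P + P * D < + n × 3 ℕ.≤ n → a ℚ.< f 3 3 n
  bound n (large , 3≤n) = ratio-above a (minMono 3 3 n) (n C 3) (choose-3-pos 3≤n)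
    (subst₂ _<_ (cong (_* + (n C 3)) (cancel A D)) (ℤ.*-comm D (+ minMono 3 3 n))
      (minMono-lower P D n (ℤ.0≤i-j⇒j≤i (0≤-of-< (proj₁ (below-target a below)))) (+≤+ (s≤s z≤n))
                     (proj₂ (below-target a below)) large))
    where
    cancel : ∀ A D → + 2 * D - (+ 2 * D - A) ≡ A
    cancel = solve-∀

f-eventually-below-main : ∀ b → b ℚ.< 1ℚ → (two ℚ.- b) ℚ.* (two ℚ.- b) ℚ.< two →
  Eventually (λ n → f 3 3 n ℚ.< b)
f-eventually-below-main b@(ℚ.mkℚ B d _) b<1 square<2 =
  eventually-map bound (eventually-× (eventually-> (+ 48 * D * D * D)) (eventually-≥ 3))
  where
  D = + suc d
  bound : ∀ n → + 48 * D * D * D < + n × 3 ℕ.≤ n → f 3 3 n ℚ.< b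
  bound n (large , 3≤n) = ratio-below b (minMono 3 3 n) (n C 3) (choose-3-pos 3≤n)
    (subst (_< B * + (n C 3)) (ℤ.*-comm D (+ minMono 3 3 n))
      (minMono-upper B d n (proj₁ (above-target b b<1 square<2)) (proj₂ (above-target b b<1 square<2)) large))

-- For b ≥ 1 it suffices to undercut 3/5, which already lies above 2 - √2.
f-eventually-below : ∀ b → AboveTarget b → Eventually (λ n → f 3 3 n ℚ.< b)
f-eventually-below b above with b ℚ.<? 1ℚ
... | yes b<1 = f-eventually-below-main b b<1 (square above)
  where
  square : AboveTarget b → (two ℚ.- b) ℚ.* (two ℚ.- b) ℚ.< two
  square (inj₁ two≤b)    = ⊥-elim (toWitnessFalse {a? = two ℚ.<? 1ℚ} _ (ℚ.≤-<-trans two≤b b<1))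
  square (inj₂ square<2) = square<2
... | no b≮1 =
  eventually-map (λ _ f<⅗ → ℚ.<-≤-trans f<⅗ (ℚ.≤-trans (ℚ.<⇒≤ ⅗<1) (ℚ.≮⇒≥ b≮1)))
                 (f-eventually-below-main ⅗ ⅗<1 (toWitness {a? = (two ℚ.- ⅗) ℚ.* (two ℚ.- ⅗) ℚ.<? two} _))
  where
  ⅗ : ℚ
  ⅗ = + 3 ℚ./ 5
  ⅗<1 : ⅗ ℚ.< 1ℚ
  ⅗<1 = toWitness {a? = ⅗ ℚ.<? 1ℚ} _

theorem1p2 : (a b : ℚ) → BelowTarget a → AboveTarget b →
    ∃ λ (N : ℕ) → (n : ℕ) → N ℕ.≤ n → (a ℚ.< f 3 3 n) × (f 3 3 n ℚ.< b)
theorem1p2 a b below above = eventually-× (f-eventually-above a below) (f-eventually-below b above)
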